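{- Let $p:\mathcal E\to\mathcal I$ be a monoidal closed fibration, $q:\mathcal D\to\mathcal J$ a type refinement system, and $(L\dashv R):p\dashv q$ an adjunction of type refinement systems giving rise to a strong monad on $p$. Let $T\sqsubset B$ be an e-type of $p$ and $U\sqsubset C$ a d-type of $q$ such that, for some expression $f:R_0L_0B\to R_0C$, $R_1L_1T$ is a pullback of $R_1U$ along $f$. Then the subtyping judgment $$\mathrm{shift}_{B,R_0C}^{*}\Big((R_1U/T)\backslash R_1U\Big)\;\le\;\eta_B^{*}\big(R_1L_1T\big)$$ is derivable.
   Context: A type refinement system is a functor $p:\mathcal E\to\mathcal I$; objects/morphisms of $\mathcal I$ are i-types/expressions, of $\mathcal E$ are e-types/derivations; composition is diagrammatic. $S\sqsubset A$ means $p(S)=A$. A derivation of $S\Rightarrow_f T$ is a morphism $\alpha:S\to T$ in $\mathcal E$ with $p(\alpha)=f$; the judgment is derivable if one exists. For $S,T\sqsubset A$, $S\le T$ denotes $S\Rightarrow_{\mathrm{id}_A}T$. For $f:A\to B$, $T\sqsubset B$, a pullback of $T$ along $f$ is an e-type $f^*T\sqsubset A$ with a cartesian derivation of $f^*T\Rightarrow_f T$ (every derivation of $S\Rightarrow_{g;f}T$ factors uniquely through it via a derivation of $S\Rightarrow_g f^*T$); a fibration has all pullbacks. $\mathcal I$ is monoidal closed with product $\otimes$, unit $\mathbf 1$, left residuals $A\backslash C$ (evaluation $\mathrm{ev}^l:A\otimes(A\backslash C)\to C$, currying bijection $\lambda:\mathrm{Hom}(A\otimes X,C)\cong\mathrm{Hom}(X,A\backslash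 C)$) and right residuals $C/B$ (evaluation $\mathrm{ev}^r:(C/B)\otimes B\to C$, bijection $\rho:\mathrm{Hom}(X\otimes B,C)\cong\mathrm{Hom}(X,C/B)$), with the usual $\beta\eta$ equations. $\mathrm{shift}_{B,C}:=\lambda(\mathrm{ev}^r):B\to (C/B)\backslash C$. A monoidal closed fibration is a fibration $p$ which is a strong monoidal functor ($S\otimes T\sqsubset A\otimes B$ when $S\sqsubset A$, $T\sqsubset B$), whose $\otimes$ preserves pullbacks, and which has for $S\sqsubset A$, $T\sqsubset B$, $U\sqsubset C$ e-types $S\backslash U\sqsubset A\backslash C$ and $U/T\sqsubset C/B$ equipped with evaluation derivations over $\mathrm{ev}^l$, $\mathrm{ev}^r$ and currying operations on derivations over $\lambda$, $\rho$ satisfying the $\beta\eta$ equations. An adjunction of type refinement systems $(L\dashv R):p\dashv q$, with $q:\mathcal D\to\mathcal J$ (objects of $\mathcal D$ called d-types), consists of functors $L_0:\mathcal I\to\mathcal J$, $L_1:\mathcal E\to\mathcal D$, $R_0:\mathcal J\to\mathcal I$, $R_1:\mathcal D\to\mathcal E$ with $qL_1=L_0p$, $pR_1=R_0q$, and adjunctions $L_0\dashv R_0$, $L_1\dashv R_1$ with units $\eta$, counits $\epsilon$, such that $p(\eta_S)=\eta_{pS}$ and $q(\epsilon_T)=\epsilon_{qT}$. It gives rise to a strong monad on $p$ if $R_0L_0$ has a strength $\sigma_{A,B}:A\otimes R_0L_0B\to R_0L_0(A\otimes B)$ and $R_1L_1$ a strength $\sigma_{S,T}:S\otimes R_1L_1T\to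 R_1L_1(S\otimes T)$, both compatible with unit and multiplication, with $p(\sigma_{S,T})=\sigma_{pS,pT}$. -}

module Defs where

open import Level using (Level; _⊔_; suc)
open import Relation.Binary.PropositionalEquality using (_≡_; subst)
open import Data.Product using (Σ; _×_; _,_)

Over : ∀ {a b} {X : Set a} (P : X → Set b) {x y : X} → P x → x ≡ y → P y → Set b
Over P u e v = subst P e u ≡ v

-- Categories (composition diagrammatic: f ⨾ g = "first f then g")

record Category (o ℓ : Level) : Set (suc (o ⊔ ℓ)) where
  field
    Obj   : Set o
    Hom   : Obj → Obj → Set ℓ
    id    : ∀ {A} → Hom A A
    _⨾_   : ∀ {A B C} → Hom A B → Hom B C → Hom A C
    idˡ   : ∀ {A B} {f : Hom A B} → (id ⨾ f) ≡ f
    idʳ   : ∀ {A B} {f : Hom A B} → (f ⨾ id) ≡ f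
    assoc : ∀ {A B C D} {f : Hom A B} {g : Hom B C} {h : Hom C D}
            → ((f ⨾ g) ⨾ h) ≡ (f ⨾ (g ⨾ h))

module _ {o ℓ o' ℓ'} (C : Category o ℓ) (D : Category o' ℓ') where
  private
    module C = Category C
    module D = Category D

  record Functor : Set (o ⊔ ℓ ⊔ o' ⊔ ℓ') where
    field
      F₀   : C.Obj → D.Obj
      F₁   : ∀ {A B} → C.Hom A B → D.Hom (F₀ A) (F₀ B)
      F-id : ∀ {A} → F₁ (C.id {A}) ≡ D.id
      F-⨾  : ∀ {A B K} {f : C.Hom A B} {g : C.Hom B K}
             → F₁ (f C.⨾ g) ≡ (F₁ f D.⨾ F₁ g)

module _ {o ℓ o' ℓ'} (C : Category o ℓ) (D : Category o' ℓ') where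
  private
    module C = Category C
    module D = Category D

  record Adjunction : Set (o ⊔ ℓ ⊔ o' ⊔ ℓ') where
    field
      L : Functor C D
      R : Functor D C
    open Functor L public renaming (F₀ to L₀; F₁ to L₁; F-id to L-id; F-⨾ to L-⨾)
    open Functor R public renaming (F₀ to R₀; F₁ to R₁; F-id to R-id; F-⨾ to R-⨾)
    field
      η     : ∀ {A} → C.Hom A (R₀ (L₀ A))
      η-nat : ∀ {A B} {f : C.Hom A B} → (f C.⨾ η) ≡ (η C.⨾ R₁ (L₁ f))
      ε     : ∀ {X} → D.Hom (L₀ (R₀ X)) X
      ε-nat : ∀ {X Y} {g : D.Hom X Y} → (L₁ (R₁ g) D.⨾ ε) ≡ (ε D.⨾ g)
      zig   : ∀ {A} → (L₁ (η {A}) D.⨾ ε) ≡ D.id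
      zag   : ∀ {X} → (η C.⨾ R₁ (ε {X})) ≡ C.id

module _ {o ℓ} (C : Category o ℓ) where
  open Category C

  record Monoidal : Set (o ⊔ ℓ) where
    field
      _⊗₀_    : Obj → Obj → Obj
      _⊗₁_    : ∀ {A B A' B'} → Hom A A' → Hom B B' → Hom (A ⊗₀ B) (A' ⊗₀ B')
      ⊗-id    : ∀ {A B} → (id {A} ⊗₁ id {B}) ≡ id
      ⊗-⨾     : ∀ {A B K A' B' K'} {f : Hom A B} {g : Hom B K} {f' : Hom A' B'} {g' : Hom B' K'}
                → ((f ⨾ g) ⊗₁ (f' ⨾ g')) ≡ ((f ⊗₁ f') ⨾ (g ⊗₁ g'))
      𝟙       : Obj
      α⇒      : ∀ {A B K} → Hom ((A ⊗₀ B) ⊗₀ K) (A ⊗₀ (B ⊗₀ K))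
      α⇐      : ∀ {A B K} → Hom (A ⊗₀ (B ⊗₀ K)) ((A ⊗₀ B) ⊗₀ K)
      α-isoˡ  : ∀ {A B K} → (α⇒ {A} {B} {K} ⨾ α⇐) ≡ id
      α-isoʳ  : ∀ {A B K} → (α⇐ {A} {B} {K} ⨾ α⇒) ≡ id
      α-nat   : ∀ {A B K A' B' K'} {f : Hom A A'} {g : Hom B B'} {h : Hom K K'}
                → (((f ⊗₁ g) ⊗₁ h) ⨾ α⇒) ≡ (α⇒ ⨾ (f ⊗₁ (g ⊗₁ h)))
      lu⇒     : ∀ {A} → Hom (𝟙 ⊗₀ A) A
      lu⇐     : ∀ {A} → Hom A (𝟙 ⊗₀ A)
      lu-isoˡ : ∀ {A} → (lu⇒ {A} ⨾ lu⇐) ≡ id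
      lu-isoʳ : ∀ {A} → (lu⇐ {A} ⨾ lu⇒) ≡ id
      lu-nat  : ∀ {A B} {f : Hom A B} → ((id {𝟙} ⊗₁ f) ⨾ lu⇒) ≡ (lu⇒ ⨾ f)
      ru⇒     : ∀ {A} → Hom (A ⊗₀ 𝟙) A
      ru⇐     : ∀ {A} → Hom A (A ⊗₀ 𝟙)
      ru-isoˡ : ∀ {A} → (ru⇒ {A} ⨾ ru⇐) ≡ id
      ru-isoʳ : ∀ {A} → (ru⇐ {A} ⨾ ru⇒) ≡ id
      ru-nat  : ∀ {A B} {f : Hom A B} → ((f ⊗₁ id {𝟙}) ⨾ ru⇒) ≡ (ru⇒ ⨾ f)
      pentagon : ∀ {A B K L}
                 → (((α⇒ {A} {B} {K} ⊗₁ id {L}) ⨾ α⇒ {A} {B ⊗₀ K} {L}) ⨾ (id {A} ⊗₁ α⇒ {B} {K} {L}))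
                   ≡ (α⇒ {A ⊗₀ B} {K} {L} ⨾ α⇒ {A} {B} {K ⊗₀ L})
      triangle : ∀ {A B} → (α⇒ {A} {𝟙} {B} ⨾ (id {A} ⊗₁ lu⇒ {B})) ≡ (ru⇒ {A} ⊗₁ id {B})

  record Closed (M : Monoidal) : Set (o ⊔ ℓ) where
    open Monoidal M
    field
      _⧵_    : Obj → Obj → Obj
      evˡ    : ∀ {A K} → Hom (A ⊗₀ (A ⧵ K)) K
      curryˡ : ∀ {A X K} → Hom (A ⊗₀ X) K → Hom X (A ⧵ K)
      βˡ     : ∀ {A X K} {h : Hom (A ⊗₀ X) K} → ((id {A} ⊗₁ curryˡ h) ⨾ evˡ {A} {K}) ≡ h
      ηˡ     : ∀ {A X K} {k : Hom X (A ⧵ K)} → curryˡ ((id {A} ⊗₁ k) ⨾ evˡ {A} {K}) ≡ k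
      _⧸_    : Obj → Obj → Obj
      evʳ    : ∀ {K B} → Hom ((K ⧸ B) ⊗₀ B) K
      curryʳ : ∀ {X B K} → Hom (X ⊗₀ B) K → Hom X (K ⧸ B)
      βʳ     : ∀ {X B K} {h : Hom (X ⊗₀ B) K} → ((curryʳ h ⊗₁ id {B}) ⨾ evʳ {K} {B}) ≡ h
      ηʳ     : ∀ {X B K} {k : Hom X (K ⧸ B)} → curryʳ ((k ⊗₁ id {B}) ⨾ evʳ {K} {B}) ≡ k

    shift : ∀ B K → Hom B ((K ⧸ B) ⧵ K)
    shift B K = curryˡ (evʳ {K} {B})

-- Type refinement systems, presented as displayed categories over I:
-- Ob A     = e-types S with S ⊏ A,
-- Der f S T = derivations of S ⇒_f T (morphisms α : S → T with p(α) = f).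

module _ {o ℓ} (C : Category o ℓ) where
  open Category C

  record RefinementSystem (o' ℓ' : Level) : Set (o ⊔ ℓ ⊔ suc (o' ⊔ ℓ')) where
    field
      Ob     : Obj → Set o'
      Der    : ∀ {A B} → Hom A B → Ob A → Ob B → Set ℓ'
      idᵈ    : ∀ {A} {S : Ob A} → Der id S S
      _⨾ᵈ_   : ∀ {A B K} {f : Hom A B} {g : Hom B K} {S T U}
               → Der f S T → Der g T U → Der (f ⨾ g) S U
      idˡᵈ   : ∀ {A B} {f : Hom A B} {S T} {φ : Der f S T}
               → Over (λ h → Der h S T) (idᵈ ⨾ᵈ φ) idˡ φ
      idʳᵈ   : ∀ {A B} {f : Hom A B} {S T} {φ : Der f S T}
               → Over (λ h → Der h S T) (φ ⨾ᵈ idᵈ) idʳ φ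
      assocᵈ : ∀ {A B K L} {f : Hom A B} {g : Hom B K} {h : Hom K L} {S T U V}
                 {φ : Der f S T} {ψ : Der g T U} {χ : Der h U V}
               → Over (λ k → Der k S V) ((φ ⨾ᵈ ψ) ⨾ᵈ χ) assoc (φ ⨾ᵈ (ψ ⨾ᵈ χ))

module _ {o ℓ o' ℓ'} {C : Category o ℓ} (E : RefinementSystem C o' ℓ') where
  open Category C
  open RefinementSystem E

  IsCartesian : ∀ {A B} {f : Hom A B} {X : Ob A} {T : Ob B} → Der f X T → Set (o ⊔ ℓ ⊔ o' ⊔ ℓ')
  IsCartesian {A} {B} {f} {X} {T} φ =
    ∀ {A'} {g : Hom A' A} {S : Ob A'} (ψ : Der (g ⨾ f) S T)
    → Σ (Der g S X) (λ γ → ((γ ⨾ᵈ φ) ≡ ψ) × (∀ (γ' : Der g S X) → (γ' ⨾ᵈ φ) ≡ ψ → γ' ≡ γ))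

  IsPullback : ∀ {A B} (f : Hom A B) (T : Ob B) (X : Ob A) → Set (o ⊔ ℓ ⊔ o' ⊔ ℓ')
  IsPullback f T X = Σ (Der f X T) IsCartesian

  _≤_ : ∀ {A} → Ob A → Ob A → Set ℓ'
  S ≤ T = Der id S T

  record Fibration : Set (o ⊔ ℓ ⊔ o' ⊔ ℓ') where
    field
      _^*_      : ∀ {A B} (f : Hom A B) → Ob B → Ob A
      lift      : ∀ {A B} {f : Hom A B} {T : Ob B} → Der f (f ^* T) T
      lift-cart : ∀ {A B} {f : Hom A B} {T : Ob B} → IsCartesian (lift {f = f} {T})

-- Monoidal closed fibrations.  p preserves ⊗, 𝟙, the coherence
-- isomorphisms, evaluations and currying on the nose: each e-level
-- operation lies over the corresponding i-level one.

module _ {o ℓ o' ℓ'} {C : Category o ℓ} (M : Monoidal C) (Cl : Closed C M)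
         (E : RefinementSystem C o' ℓ') where
  open Category C
  open Monoidal M
  open Closed Cl
  open RefinementSystem E

  record MonoidalClosedFibration : Set (o ⊔ ℓ ⊔ o' ⊔ ℓ') where
    field
      fibration : Fibration E
      _⊗ᵈ₀_   : ∀ {A B} → Ob A → Ob B → Ob (A ⊗₀ B)
      _⊗ᵈ₁_   : ∀ {A B A' B'} {f : Hom A A'} {g : Hom B B'} {S T S' T'}
                → Der f S S' → Der g T T' → Der (f ⊗₁ g) (S ⊗ᵈ₀ T) (S' ⊗ᵈ₀ T')
      ⊗-idᵈ   : ∀ {A B} {S : Ob A} {T : Ob B}
                → Over (λ h → Der h (S ⊗ᵈ₀ T) (S ⊗ᵈ₀ T)) (idᵈ ⊗ᵈ₁ idᵈ) ⊗-id idᵈ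
      ⊗-⨾ᵈ    : ∀ {A B K A' B' K'} {f : Hom A B} {g : Hom B K} {f' : Hom A' B'} {g' : Hom B' K'}
                  {S T U S' T' U'} {φ : Der f S T} {ψ : Der g T U} {φ' : Der f' S' T'} {ψ' : Der g' T' U'}
                → Over (λ h → Der h (S ⊗ᵈ₀ S') (U ⊗ᵈ₀ U')) ((φ ⨾ᵈ ψ) ⊗ᵈ₁ (φ' ⨾ᵈ ψ')) ⊗-⨾
                       ((φ ⊗ᵈ₁ φ') ⨾ᵈ (ψ ⊗ᵈ₁ ψ'))
      𝟙ᵈ      : Ob 𝟙
      α⇒ᵈ     : ∀ {A B K} {S : Ob A} {T : Ob B} {U : Ob K}
                → Der α⇒ ((S ⊗ᵈ₀ T) ⊗ᵈ₀ U) (S ⊗ᵈ₀ (T ⊗ᵈ₀ U))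
      α⇐ᵈ     : ∀ {A B K} {S : Ob A} {T : Ob B} {U : Ob K}
                → Der α⇐ (S ⊗ᵈ₀ (T ⊗ᵈ₀ U)) ((S ⊗ᵈ₀ T) ⊗ᵈ₀ U)
      α-isoˡᵈ : ∀ {A B K} {S : Ob A} {T : Ob B} {U : Ob K}
                → Over (λ h → Der h ((S ⊗ᵈ₀ T) ⊗ᵈ₀ U) ((S ⊗ᵈ₀ T) ⊗ᵈ₀ U)) (α⇒ᵈ {S = S} {T} {U} ⨾ᵈ α⇐ᵈ) α-isoˡ idᵈ
      α-isoʳᵈ : ∀ {A B K} {S : Ob A} {T : Ob B} {U : Ob K}
                → Over (λ h → Der h (S ⊗ᵈ₀ (T ⊗ᵈ₀ U)) (S ⊗ᵈ₀ (T ⊗ᵈ₀ U))) (α⇐ᵈ {S = S} {T} {U} ⨾ᵈ α⇒ᵈ) α-isoʳ idᵈ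
      α-natᵈ  : ∀ {A B K A' B' K'} {f : Hom A A'} {g : Hom B B'} {h : Hom K K'}
                  {S T U S' T' U'} {φ : Der f S S'} {ψ : Der g T T'} {χ : Der h U U'}
                → Over (λ k → Der k ((S ⊗ᵈ₀ T) ⊗ᵈ₀ U) (S' ⊗ᵈ₀ (T' ⊗ᵈ₀ U')))
                       (((φ ⊗ᵈ₁ ψ) ⊗ᵈ₁ χ) ⨾ᵈ α⇒ᵈ) α-nat (α⇒ᵈ ⨾ᵈ (φ ⊗ᵈ₁ (ψ ⊗ᵈ₁ χ)))
      lu⇒ᵈ    : ∀ {A} {S : Ob A} → Der lu⇒ (𝟙ᵈ ⊗ᵈ₀ S) S
      lu⇐ᵈ    : ∀ {A} {S : Ob A} → Der lu⇐ S (𝟙ᵈ ⊗ᵈ₀ S)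
      lu-isoˡᵈ : ∀ {A} {S : Ob A} → Over (λ h → Der h (𝟙ᵈ ⊗ᵈ₀ S) (𝟙ᵈ ⊗ᵈ₀ S)) (lu⇒ᵈ {S = S} ⨾ᵈ lu⇐ᵈ) lu-isoˡ idᵈ
      lu-isoʳᵈ : ∀ {A} {S : Ob A} → Over (λ h → Der h S S) (lu⇐ᵈ {S = S} ⨾ᵈ lu⇒ᵈ) lu-isoʳ idᵈ
      lu-natᵈ : ∀ {A B} {f : Hom A B} {S T} {φ : Der f S T}
                → Over (λ h → Der h (𝟙ᵈ ⊗ᵈ₀ S) T) ((idᵈ ⊗ᵈ₁ φ) ⨾ᵈ lu⇒ᵈ) lu-nat (lu⇒ᵈ ⨾ᵈ φ)
      ru⇒ᵈ    : ∀ {A} {S : Ob A} → Der ru⇒ (S ⊗ᵈ₀ 𝟙ᵈ) S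
      ru⇐ᵈ    : ∀ {A} {S : Ob A} → Der ru⇐ S (S ⊗ᵈ₀ 𝟙ᵈ)
      ru-isoˡᵈ : ∀ {A} {S : Ob A} → Over (λ h → Der h (S ⊗ᵈ₀ 𝟙ᵈ) (S ⊗ᵈ₀ 𝟙ᵈ)) (ru⇒ᵈ {S = S} ⨾ᵈ ru⇐ᵈ) ru-isoˡ idᵈ
      ru-isoʳᵈ : ∀ {A} {S : Ob A} → Over (λ h → Der h S S) (ru⇐ᵈ {S = S} ⨾ᵈ ru⇒ᵈ) ru-isoʳ idᵈ
      ru-natᵈ : ∀ {A B} {f : Hom A B} {S T} {φ : Der f S T}
                → Over (λ h → Der h (S ⊗ᵈ₀ 𝟙ᵈ) T) ((φ ⊗ᵈ₁ idᵈ) ⨾ᵈ ru⇒ᵈ) ru-nat (ru⇒ᵈ ⨾ᵈ φ)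
      pentagonᵈ : ∀ {A B K L} {S : Ob A} {T : Ob B} {U : Ob K} {V : Ob L}
                  → Over (λ h → Der h (((S ⊗ᵈ₀ T) ⊗ᵈ₀ U) ⊗ᵈ₀ V) (S ⊗ᵈ₀ (T ⊗ᵈ₀ (U ⊗ᵈ₀ V))))
                         (((α⇒ᵈ {S = S} {T} {U} ⊗ᵈ₁ idᵈ {S = V}) ⨾ᵈ α⇒ᵈ {S = S} {T ⊗ᵈ₀ U} {V})
                            ⨾ᵈ (idᵈ {S = S} ⊗ᵈ₁ α⇒ᵈ {S = T} {U} {V}))
                         pentagon
                         (α⇒ᵈ {S = S ⊗ᵈ₀ T} {U} {V} ⨾ᵈ α⇒ᵈ {S = S} {T} {U ⊗ᵈ₀ V})
      triangleᵈ : ∀ {A B} {S : Ob A} {T : Ob B}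
                  → Over (λ h → Der h ((S ⊗ᵈ₀ 𝟙ᵈ) ⊗ᵈ₀ T) (S ⊗ᵈ₀ T))
                         (α⇒ᵈ {S = S} {𝟙ᵈ} {T} ⨾ᵈ (idᵈ {S = S} ⊗ᵈ₁ lu⇒ᵈ {S = T}))
                         triangle (ru⇒ᵈ {S = S} ⊗ᵈ₁ idᵈ {S = T})
      ⊗-cart  : ∀ {A B A' B'} {f : Hom A A'} {g : Hom B B'} {S T S' T'}
                  {φ : Der f S S'} {ψ : Der g T T'}
                → IsCartesian E φ → IsCartesian E ψ → IsCartesian E (φ ⊗ᵈ₁ ψ)
      _⧵ᵈ_     : ∀ {A K} → Ob A → Ob K → Ob (A ⧵ K)
      evˡᵈ     : ∀ {A K} {S : Ob A} {U : Ob K} → Der (evˡ {A} {K}) (S ⊗ᵈ₀ (S ⧵ᵈ U)) U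
      curryˡᵈ  : ∀ {A X K} {h : Hom (A ⊗₀ X) K} {S : Ob A} {Y : Ob X} {U : Ob K}
                 → Der h (S ⊗ᵈ₀ Y) U → Der (curryˡ h) Y (S ⧵ᵈ U)
      βˡᵈ      : ∀ {A X K} {h : Hom (A ⊗₀ X) K} {S : Ob A} {Y : Ob X} {U : Ob K}
                   {φ : Der h (S ⊗ᵈ₀ Y) U}
                 → Over (λ k → Der k (S ⊗ᵈ₀ Y) U)
                        ((idᵈ {S = S} ⊗ᵈ₁ curryˡᵈ φ) ⨾ᵈ evˡᵈ {S = S} {U}) βˡ φ
      ηˡᵈ      : ∀ {A X K} {k : Hom X (A ⧵ K)} {S : Ob A} {Y : Ob X} {U : Ob K}
                   {κ : Der k Y (S ⧵ᵈ U)}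
                 → Over (λ k' → Der k' Y (S ⧵ᵈ U))
                        (curryˡᵈ ((idᵈ {S = S} ⊗ᵈ₁ κ) ⨾ᵈ evˡᵈ {S = S} {U})) ηˡ κ
      _⧸ᵈ_     : ∀ {K B} → Ob K → Ob B → Ob (K ⧸ B)
      evʳᵈ     : ∀ {K B} {U : Ob K} {T : Ob B} → Der (evʳ {K} {B}) ((U ⧸ᵈ T) ⊗ᵈ₀ T) U
      curryʳᵈ  : ∀ {X B K} {h : Hom (X ⊗₀ B) K} {Y : Ob X} {T : Ob B} {U : Ob K}
                 → Der h (Y ⊗ᵈ₀ T) U → Der (curryʳ h) Y (U ⧸ᵈ T)
      βʳᵈ      : ∀ {X B K} {h : Hom (X ⊗₀ B) K} {Y : Ob X} {T : Ob B} {U : Ob K}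
                   {φ : Der h (Y ⊗ᵈ₀ T) U}
                 → Over (λ k → Der k (Y ⊗ᵈ₀ T) U)
                        ((curryʳᵈ φ ⊗ᵈ₁ idᵈ {S = T}) ⨾ᵈ evʳᵈ {U = U} {T}) βʳ φ
      ηʳᵈ      : ∀ {X B K} {k : Hom X (K ⧸ B)} {Y : Ob X} {T : Ob B} {U : Ob K}
                   {κ : Der k Y (U ⧸ᵈ T)}
                 → Over (λ k' → Der k' Y (U ⧸ᵈ T))
                        (curryʳᵈ ((κ ⊗ᵈ₁ idᵈ {S = T}) ⨾ᵈ evʳᵈ {U = U} {T})) ηʳ κ
    open Fibration fibration public

module _ {o ℓ o' ℓ' p m p' m'} {C : Category o ℓ} {D : Category p m}
         (F : Functor C D) (E : RefinementSystem C o' ℓ') (E' : RefinementSystem D p' m') where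
  private
    module C = Category C
    module E = RefinementSystem E
    module E' = RefinementSystem E'
  open Functor F

  record FunctorOver : Set (o ⊔ ℓ ⊔ o' ⊔ ℓ' ⊔ p' ⊔ m') where
    field
      F₀ᵈ   : ∀ {A} → E.Ob A → E'.Ob (F₀ A)
      F₁ᵈ   : ∀ {A B} {f : C.Hom A B} {S T} → E.Der f S T → E'.Der (F₁ f) (F₀ᵈ S) (F₀ᵈ T)
      F-idᵈ : ∀ {A} {S : E.Ob A}
              → Over (λ h → E'.Der h (F₀ᵈ S) (F₀ᵈ S)) (F₁ᵈ (E.idᵈ {S = S})) F-id E'.idᵈ
      F-⨾ᵈ  : ∀ {A B K} {f : C.Hom A B} {g : C.Hom B K} {S T U} {φ : E.Der f S T} {ψ : E.Der g T U}
              → Over (λ h → E'.Der h (F₀ᵈ S) (F₀ᵈ U)) (F₁ᵈ (φ E.⨾ᵈ ψ)) F-⨾ (F₁ᵈ φ E'.⨾ᵈ F₁ᵈ ψ)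

module _ {o ℓ o' ℓ' p m p' m'} {I : Category o ℓ} {J : Category p m}
         (Adj : Adjunction I J) (E : RefinementSystem I o' ℓ') (D : RefinementSystem J p' m') where
  private
    module I = Category I
    module J = Category J
    module E = RefinementSystem E
    module D = RefinementSystem D
  open Adjunction Adj

  record AdjunctionOver : Set (o ⊔ ℓ ⊔ p ⊔ m ⊔ o' ⊔ ℓ' ⊔ p' ⊔ m') where
    field
      L₁ᵈ : FunctorOver L E D
      R₁ᵈ : FunctorOver R D E
    open FunctorOver L₁ᵈ public renaming (F₀ᵈ to Lᵈ₀; F₁ᵈ to Lᵈ₁; F-idᵈ to L-idᵈ; F-⨾ᵈ to L-⨾ᵈ)
    open FunctorOver R₁ᵈ public renaming (F₀ᵈ to Rᵈ₀; F₁ᵈ to Rᵈ₁; F-idᵈ to R-idᵈ; F-⨾ᵈ to R-⨾ᵈ)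
    field
      ηᵈ     : ∀ {A} {S : E.Ob A} → E.Der (η {A}) S (Rᵈ₀ (Lᵈ₀ S))
      η-natᵈ : ∀ {A B} {f : I.Hom A B} {S T} {φ : E.Der f S T}
               → Over (λ h → E.Der h S (Rᵈ₀ (Lᵈ₀ T))) (φ E.⨾ᵈ ηᵈ) η-nat (ηᵈ E.⨾ᵈ Rᵈ₁ (Lᵈ₁ φ))
      εᵈ     : ∀ {X} {U : D.Ob X} → D.Der (ε {X}) (Lᵈ₀ (Rᵈ₀ U)) U
      ε-natᵈ : ∀ {X Y} {g : J.Hom X Y} {U V} {ψ : D.Der g U V}
               → Over (λ h → D.Der h (Lᵈ₀ (Rᵈ₀ U)) V) (Lᵈ₁ (Rᵈ₁ ψ) D.⨾ᵈ εᵈ) ε-nat (εᵈ D.⨾ᵈ ψ)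
      zigᵈ   : ∀ {A} {S : E.Ob A}
               → Over (λ h → D.Der h (Lᵈ₀ S) (Lᵈ₀ S)) (Lᵈ₁ (ηᵈ {S = S}) D.⨾ᵈ εᵈ) zig D.idᵈ
      zagᵈ   : ∀ {X} {U : D.Ob X}
               → Over (λ h → E.Der h (Rᵈ₀ U) (Rᵈ₀ U)) (ηᵈ E.⨾ᵈ Rᵈ₁ (εᵈ {U = U})) zag E.idᵈ

module _ {o ℓ p m} {I : Category o ℓ} {J : Category p m} (Adj : Adjunction I J) where
  open Category I
  open Adjunction Adj

  T₀ : Obj → Obj
  T₀ A = R₀ (L₀ A)

  T₁ : ∀ {A B} → Hom A B → Hom (T₀ A) (T₀ B)
  T₁ f = R₁ (L₁ f)

  μ : ∀ {A} → Hom (T₀ (T₀ A)) (T₀ A)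
  μ {A} = R₁ (ε {L₀ A})

module _ {o ℓ p m} {I : Category o ℓ} {J : Category p m} (M : Monoidal I) (Adj : Adjunction I J) where
  open Category I
  open Monoidal M
  open Adjunction Adj

  private
    T₀′ = T₀ Adj
    T₁′ : ∀ {A B} → Hom A B → Hom (T₀′ A) (T₀′ B)
    T₁′ = T₁ Adj
    μ′ : ∀ {A} → Hom (T₀′ (T₀′ A)) (T₀′ A)
    μ′ = μ Adj

  record Strength : Set (o ⊔ ℓ) where
    field
      σ     : ∀ {A B} → Hom (A ⊗₀ T₀′ B) (T₀′ (A ⊗₀ B))
      σ-nat : ∀ {A B A' B'} {f : Hom A A'} {g : Hom B B'}
              → ((f ⊗₁ T₁′ g) ⨾ σ) ≡ (σ ⨾ T₁′ (f ⊗₁ g))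
      σ-η   : ∀ {A B} → ((id {A} ⊗₁ η {B}) ⨾ σ) ≡ η {A ⊗₀ B}
      σ-μ   : ∀ {A B} → ((id {A} ⊗₁ μ′ {B}) ⨾ σ {A} {B})
                        ≡ ((σ {A} {T₀′ B} ⨾ T₁′ (σ {A} {B})) ⨾ μ′ {A ⊗₀ B})

module _ {o ℓ o' ℓ' p m p' m'} {I : Category o ℓ} {J : Category p m}
         {M : Monoidal I} {Cl : Closed I M} {E : RefinementSystem I o' ℓ'} {D : RefinementSystem J p' m'}
         (MCF : MonoidalClosedFibration M Cl E) {Adj : Adjunction I J}
         (Adjᵈ : AdjunctionOver Adj E D) (St : Strength M Adj) where
  open Category I
  open Monoidal M
  open Adjunction Adj
  open RefinementSystem E
  open MonoidalClosedFibration MCF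
  open AdjunctionOver Adjᵈ
  open Strength St

  Tᵈ₀ : ∀ {A} → Ob A → Ob (T₀ Adj A)
  Tᵈ₀ S = Rᵈ₀ (Lᵈ₀ S)

  Tᵈ₁ : ∀ {A B} {f : Hom A B} {S T} → Der f S T → Der (T₁ Adj f) (Tᵈ₀ S) (Tᵈ₀ T)
  Tᵈ₁ φ = Rᵈ₁ (Lᵈ₁ φ)

  μᵈ : ∀ {A} {S : Ob A} → Der (μ Adj {A}) (Tᵈ₀ (Tᵈ₀ S)) (Tᵈ₀ S)
  μᵈ {S = S} = Rᵈ₁ (εᵈ {U = Lᵈ₀ S})

  record StrengthOver : Set (o ⊔ ℓ ⊔ o' ⊔ ℓ') where
    field
      σᵈ     : ∀ {A B} {S : Ob A} {T : Ob B} → Der (σ {A} {B}) (S ⊗ᵈ₀ Tᵈ₀ T) (Tᵈ₀ (S ⊗ᵈ₀ T))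
      σ-natᵈ : ∀ {A B A' B'} {f : Hom A A'} {g : Hom B B'} {S T S' T'}
                 {φ : Der f S S'} {ψ : Der g T T'}
               → Over (λ h → Der h (S ⊗ᵈ₀ Tᵈ₀ T) (Tᵈ₀ (S' ⊗ᵈ₀ T')))
                      ((φ ⊗ᵈ₁ Tᵈ₁ ψ) ⨾ᵈ σᵈ) σ-nat (σᵈ ⨾ᵈ Tᵈ₁ (φ ⊗ᵈ₁ ψ))
      σ-ηᵈ   : ∀ {A B} {S : Ob A} {T : Ob B}
               → Over (λ h → Der h (S ⊗ᵈ₀ T) (Tᵈ₀ (S ⊗ᵈ₀ T)))
                      ((idᵈ {S = S} ⊗ᵈ₁ ηᵈ {S = T}) ⨾ᵈ σᵈ) σ-η (ηᵈ {S = S ⊗ᵈ₀ T})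
      σ-μᵈ   : ∀ {A B} {S : Ob A} {T : Ob B}
               → Over (λ h → Der h (S ⊗ᵈ₀ Tᵈ₀ (Tᵈ₀ T)) (Tᵈ₀ (S ⊗ᵈ₀ T)))
                      ((idᵈ {S = S} ⊗ᵈ₁ μᵈ {S = T}) ⨾ᵈ σᵈ {S = S} {T}) σ-μ
                      ((σᵈ {S = S} {Tᵈ₀ T} ⨾ᵈ Tᵈ₁ (σᵈ {S = S} {T})) ⨾ᵈ μᵈ {S = S ⊗ᵈ₀ T})

module Submission where

-- Write X for shift_{B,R₀C}^*((R₁U ⧸ T) ⧵ R₁U) and f : R₀L₀B → R₀C
-- for the expression along which R₁L₁T is a pullback of R₁U, with cartesian
-- derivation φ.  Composing the unit with φ gives a derivation T ⇒_{η;f} R₁U.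
--
--  1. In any monoidal closed fibration, a derivation ψ : T ⇒_g U induces a
--     derivation shift^*((U ⧸ T) ⧵ U) ⇒_g U: curry ψ to its "name"
--     𝟙 ⇒ U ⧸ T and feed it to the left evaluation after the cartesian lift
--     along shift.  Over the base this is the identity  name(g) · shift = g,
--     a consequence of the β-laws of both residuals (apply-name).
--  2. Applying this to η;φ gives X ⇒_{η;f} R₁U, which factors through the
--     cartesian φ as X ⇒_η R₁L₁T.
--  3. In a fibration, S ⇒_h T is the same as S ≤ h^*T; hence X ≤ η^*(R₁L₁T).

open import Defs
open import Level using (Level)
open import Data.Product using (Σ; _,_; proj₁)
open import Relation.Binary.PropositionalEquality
  using (_≡_; sym; trans; cong; cong₂; subst; module ≡-Reasoning)

module _ {o ℓ o' ℓ'} {C : Category o ℓ} (E : RefinementSystem C o' ℓ') where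
  open Category C
  open RefinementSystem E

  retype : ∀ {A B} {f g : Hom A B} {S : Ob A} {T : Ob B} → f ≡ g → Der f S T → Der g S T
  retype {S = S} {T} = subst (λ h → Der h S T)

  factor : ∀ {A A' B} {f : Hom A B} {g : Hom A' A} {S : Ob A'} {X : Ob A} {T : Ob B}
             {φ : Der f X T} → IsCartesian E φ → Der (g ⨾ f) S T → Der g S X
  factor cart ψ = proj₁ (cart ψ)

  ≤-pullback : (Fib : Fibration E) → ∀ {A B} {f : Hom A B} {S : Ob A} {T : Ob B}
             → Der f S T → _≤_ E S (Fibration._^*_ Fib f T)
  ≤-pullback Fib ψ = factor lift-cart (retype (sym idˡ) ψ)
    where open Fibration Fib

module _ {o ℓ} {C : Category o ℓ} {M : Monoidal C} (Cl : Closed C M) where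
  open Category C
  open Monoidal M
  open Closed Cl
  open ≡-Reasoning

  ⊗-split : ∀ {A B A' B'} {f : Hom A A'} {g : Hom B B'}
          → (f ⊗₁ g) ≡ ((f ⊗₁ id) ⨾ (id ⊗₁ g))
  ⊗-split = trans (cong₂ _⊗₁_ (sym idʳ) (sym idˡ)) ⊗-⨾

  shift-ev : ∀ {X B K} {k : Hom X (K ⧸ B)}
           → ((k ⊗₁ shift B K) ⨾ evˡ) ≡ ((k ⊗₁ id) ⨾ evʳ)
  shift-ev {B = B} {K} {k} = begin
    (k ⊗₁ shift B K) ⨾ evˡ                ≡⟨ cong (_⨾ evˡ) ⊗-split ⟩
    ((k ⊗₁ id) ⨾ (id ⊗₁ shift B K)) ⨾ evˡ ≡⟨ assoc ⟩
    (k ⊗₁ id) ⨾ ((id ⊗₁ shift B K) ⨾ evˡ) ≡⟨ cong ((k ⊗₁ id) ⨾_) βˡ ⟩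
    (k ⊗₁ id) ⨾ evʳ                       ∎

  name : ∀ {B K} → Hom B K → Hom 𝟙 (K ⧸ B)
  name g = curryʳ (lu⇒ ⨾ g)

  apply-name : ∀ {B K} {g : Hom B K}
             → ((lu⇐ ⨾ (name g ⊗₁ shift B K)) ⨾ evˡ) ≡ g
  apply-name {B} {K} {g} = begin
    (lu⇐ ⨾ (name g ⊗₁ shift B K)) ⨾ evˡ   ≡⟨ assoc ⟩
    lu⇐ ⨾ ((name g ⊗₁ shift B K) ⨾ evˡ)   ≡⟨ cong (lu⇐ ⨾_) (trans shift-ev βʳ) ⟩
    lu⇐ ⨾ (lu⇒ ⨾ g)                       ≡⟨ sym assoc ⟩
    (lu⇐ ⨾ lu⇒) ⨾ g                       ≡⟨ cong (_⨾ g) lu-isoʳ ⟩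
    id ⨾ g                                ≡⟨ idˡ ⟩
    g                                     ∎

module _ {o ℓ o' ℓ'} {C : Category o ℓ} {M : Monoidal C} {Cl : Closed C M}
         {E : RefinementSystem C o' ℓ'} (MCF : MonoidalClosedFibration M Cl E) where
  open Category C
  open Monoidal M
  open Closed Cl
  open RefinementSystem E
  open MonoidalClosedFibration MCF

  nameᵈ : ∀ {B K} {g : Hom B K} {T : Ob B} {U : Ob K}
        → Der g T U → Der (name Cl g) 𝟙ᵈ (U ⧸ᵈ T)
  nameᵈ ψ = curryʳᵈ (lu⇒ᵈ ⨾ᵈ ψ)

  shift-apply : ∀ {B K} {g : Hom B K} {T : Ob B} {U : Ob K}
              → Der g T U → Der g (shift B K ^* ((U ⧸ᵈ T) ⧵ᵈ U)) U
  shift-apply ψ = retype E (apply-name Cl) ((lu⇐ᵈ ⨾ᵈ (nameᵈ ψ ⊗ᵈ₁ lift)) ⨾ᵈ evˡᵈ)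

mainTheorem3 : ∀ {o ℓ o' ℓ' p m p' m' : Level}
    {I : Category o ℓ} {J : Category p m}
    {M : Monoidal I} {Cl : Closed I M}
    {E : RefinementSystem I o' ℓ'} {D : RefinementSystem J p' m'}
    (MCF : MonoidalClosedFibration M Cl E)
    {Adj : Adjunction I J} (Adjᵈ : AdjunctionOver Adj E D)
    (St : Strength M Adj) (Stᵈ : StrengthOver MCF Adjᵈ St)
    {B : Category.Obj I} {C : Category.Obj J}
    (T : RefinementSystem.Ob E B) (U : RefinementSystem.Ob D C)
    → Σ (Category.Hom I (Adjunction.R₀ Adj (Adjunction.L₀ Adj B)) (Adjunction.R₀ Adj C))
    (λ f → IsPullback E f (AdjunctionOver.Rᵈ₀ Adjᵈ U)
    (AdjunctionOver.Rᵈ₀ Adjᵈ (AdjunctionOver.Lᵈ₀ Adjᵈ T)))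
    → _≤_ E
    (MonoidalClosedFibration._^*_ MCF
    (Closed.shift Cl B (Adjunction.R₀ Adj C))
    (MonoidalClosedFibration._⧵ᵈ_ MCF
    (MonoidalClosedFibration._⧸ᵈ_ MCF (AdjunctionOver.Rᵈ₀ Adjᵈ U) T)
    (AdjunctionOver.Rᵈ₀ Adjᵈ U)))
    (MonoidalClosedFibration._^*_ MCF
    (Adjunction.η Adj {B})
    (AdjunctionOver.Rᵈ₀ Adjᵈ (AdjunctionOver.Lᵈ₀ Adjᵈ T)))
mainTheorem3 {E = E} MCF Adjᵈ _ _ T U (_ , φ , φ-cart) =
  ≤-pullback E fibration (factor E φ-cart (shift-apply MCF (ηᵈ ⨾ᵈ φ)))
  where
  open MonoidalClosedFibration MCF using (fibration)
  open AdjunctionOver Adjᵈ using (ηᵈ)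
  open RefinementSystem E using (_⨾ᵈ_)
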